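{- Let $L$ be a lattice with join $\vee$, meet $\wedge$ and order $\leq$, and let $b : L \times L \to \mathbb{R}$ be a bi-quantification, written $b([\mathbf{x},\mathbf{t}])$ for $(\mathbf{x},\mathbf{t}) \in L \times L$, satisfying: (i) (sum rule) for all $\mathbf{x},\mathbf{y},\mathbf{t} \in L$: $b([\mathbf{x} \vee \mathbf{y}, \mathbf{t}]) = b([\mathbf{x},\mathbf{t}]) + b([\mathbf{y},\mathbf{t}]) - b([\mathbf{x} \wedge \mathbf{y}, \mathbf{t}])$; (ii) (chain rule) for all $\mathbf{u} \leq \mathbf{v} \leq \mathbf{w}$ in $L$: $b([\mathbf{u},\mathbf{w}]) = b([\mathbf{u},\mathbf{v}])\, b([\mathbf{v},\mathbf{w}])$; (iii) for all $\mathbf{x},\mathbf{y} \in L$ with $\mathbf{y} \geq \mathbf{x}$: $b([\mathbf{y},\mathbf{x}]) = 1$. Then for all $\mathbf{x},\mathbf{y},\mathbf{z} \in L$, $$b([\mathbf{y} \wedge \mathbf{z}, \mathbf{x}]) = b([\mathbf{z}, \mathbf{x} \wedge \mathbf{y}])\, b([\mathbf{y}, \mathbf{x}]).$$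
   Context: A bi-quantification is a function assigning a real number $b([\mathbf{x},\mathbf{t}])$ to each ordered pair (directed interval) of lattice elements; the second element $\mathbf{t}$ is called the context. -}

module Defs where

open import Level using (Level; _⊔_)
open import Relation.Binary.Lattice.Bundles using (Lattice)
open import Algebra.Bundles using (CommutativeRing)

-- A bi-quantification on a lattice L with values in a commutative ring R
-- (stand-in for ℝ, which agda-stdlib lacks): a function L × L → R,
-- written curried, b x t = b([x,t]); t is the context.
-- Since the lattice carries a setoid equality, b is required to respect it.
module _ {c ℓ₁ ℓ₂ r ℓr : Level} (L : Lattice c ℓ₁ ℓ₂) (R : CommutativeRing r ℓr) where
  private
    module L = Lattice L
    module R = CommutativeRing R

  BiQuant : Set (c ⊔ r)
  BiQuant = L.Carrier → L.Carrier → R.Carrier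

  Respects : BiQuant → Set (c ⊔ ℓ₁ ⊔ ℓr)
  Respects b = ∀ {x x′ t t′} → x L.≈ x′ → t L.≈ t′ → b x t R.≈ b x′ t′

  SumRule : BiQuant → Set (c ⊔ ℓr)
  SumRule b = ∀ x y t →
    b (x L.∨ y) t R.≈ (b x t R.+ b y t) R.- b (x L.∧ y) t

  ChainRule : BiQuant → Set (c ⊔ ℓ₂ ⊔ ℓr)
  ChainRule b = ∀ u v w → u L.≤ v → v L.≤ w →
    b u w R.≈ b u v R.* b v w

  UnitRule : BiQuant → Set (c ⊔ ℓ₂ ⊔ ℓr)
  UnitRule b = ∀ x y → x L.≤ y → b y x R.≈ R.1#

-- Intersecting with the context does not change b: by the sum rule and
-- b([x ∨ t, t]) = b([t, t]) = 1 we get b([x, t]) = b([x ∧ t, t]).  Hence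
-- b([y ∧ z, x]) = b([x ∧ y ∧ z, x]), and the chain x ∧ y ∧ z ≤ x ∧ y ≤ x
-- splits this into b([x ∧ y ∧ z, x ∧ y]) b([x ∧ y, x]), whose factors are
-- b([z, x ∧ y]) and b([y, x]) by the same observation.
module Submission where

open import Defs
open import Relation.Binary.Lattice.Bundles using (Lattice)
open import Algebra.Bundles using (AbelianGroup; CommutativeRing)
import Algebra.Properties.Group as GroupProperties
import Relation.Binary.Lattice.Properties.MeetSemilattice as MeetProperties
import Relation.Binary.Reasoning.Setoid as SetoidReasoning

module _ {a ℓ} (G : AbelianGroup a ℓ) where
  open AbelianGroup G
  open GroupProperties group using (∙-cancelʳ; x∙y⁻¹≈ε⇒x≈y)
  open SetoidReasoning setoid

  x∙u∙y⁻¹≈u⇒x≈y : ∀ x y u → (x ∙ u) ∙ y ⁻¹ ≈ u → x ≈ y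
  x∙u∙y⁻¹≈u⇒x≈y x y u eq = x∙y⁻¹≈ε⇒x≈y x y (∙-cancelʳ u _ _ (begin
    (x ∙ y ⁻¹) ∙ u  ≈⟨ assoc x (y ⁻¹) u ⟩
    x ∙ (y ⁻¹ ∙ u)  ≈⟨ ∙-congˡ (comm (y ⁻¹) u) ⟩
    x ∙ (u ∙ y ⁻¹)  ≈⟨ assoc x u (y ⁻¹) ⟨
    (x ∙ u) ∙ y ⁻¹  ≈⟨ eq ⟩
    u               ≈⟨ identityˡ u ⟨
    ε ∙ u           ∎))

module _ {c ℓ₁ ℓ₂} (L : Lattice c ℓ₁ ℓ₂) where
  open Lattice L using (_≈_; _∧_; setoid; module Eq)
  open MeetProperties (Lattice.meetSemilattice L) using (∧-cong; ∧-comm; ∧-assoc)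
  open SetoidReasoning setoid

  z∧[x∧y]≈[y∧z]∧x : ∀ x y z → z ∧ (x ∧ y) ≈ (y ∧ z) ∧ x
  z∧[x∧y]≈[y∧z]∧x x y z = begin
    z ∧ (x ∧ y)  ≈⟨ ∧-cong Eq.refl (∧-comm x y) ⟩
    z ∧ (y ∧ x)  ≈⟨ ∧-assoc z y x ⟨
    (z ∧ y) ∧ x  ≈⟨ ∧-cong (∧-comm z y) Eq.refl ⟩
    (y ∧ z) ∧ x  ∎

module _ {c ℓ₁ ℓ₂ r ℓr} (L : Lattice c ℓ₁ ℓ₂) (R : CommutativeRing r ℓr)
         (b : BiQuant L R) where
  open Lattice L using (_∧_; _∨_; y≤x∨y) renaming (refl to ≤-refl)
  open CommutativeRing R

  b[x,t]≈b[x∧t,t] : SumRule L R b → UnitRule L R b → ∀ x t → b x t ≈ b (x ∧ t) t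
  b[x,t]≈b[x∧t,t] sumRule unitRule x t =
    x∙u∙y⁻¹≈u⇒x≈y +-abelianGroup (b x t) (b (x ∧ t) t) (b t t) (begin
      (b x t + b t t) - b (x ∧ t) t  ≈⟨ sumRule x t t ⟨
      b (x ∨ t) t                    ≈⟨ unitRule t (x ∨ t) (y≤x∨y x t) ⟩
      1#                             ≈⟨ unitRule t t ≤-refl ⟨
      b t t                          ∎)
    where open SetoidReasoning setoid

mainTheorem1 : ∀ {c ℓ₁ ℓ₂ r ℓr} (L : Lattice c ℓ₁ ℓ₂) (R : CommutativeRing r ℓr)
    (b : BiQuant L R) → Respects L R b →
    SumRule L R b → ChainRule L R b → UnitRule L R b →
    ∀ x y z →
    CommutativeRing._≈_ R (b (Lattice._∧_ L y z) x)
    (CommutativeRing._*_ R (b z (Lattice._∧_ L x y)) (b y x))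
mainTheorem1 L R b respects sumRule chainRule unitRule x y z = begin
  b (y ∧ z) x                                ≈⟨ intersectContext (y ∧ z) x ⟩
  b ((y ∧ z) ∧ x) x                          ≈⟨ chainRule _ _ _ [y∧z]∧x≤y∧x (x∧y≤y y x) ⟩
  b ((y ∧ z) ∧ x) (y ∧ x) * b (y ∧ x) x      ≈⟨ *-cong reorder (intersectContext y x) ⟨
  b (z ∧ (x ∧ y)) (x ∧ y) * b y x            ≈⟨ *-congʳ (intersectContext z (x ∧ y)) ⟨
  b z (x ∧ y) * b y x                        ∎
  where
  open Lattice L using (_∧_; _≤_; x∧y≤x; x∧y≤y) renaming (refl to ≤-refl)
  open MeetProperties (Lattice.meetSemilattice L) using (∧-comm; ∧-monotonic)
  open CommutativeRing R
  open SetoidReasoning setoid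

  intersectContext : ∀ u t → b u t ≈ b (u ∧ t) t
  intersectContext = b[x,t]≈b[x∧t,t] L R b sumRule unitRule

  reorder : b (z ∧ (x ∧ y)) (x ∧ y) ≈ b ((y ∧ z) ∧ x) (y ∧ x)
  reorder = respects (z∧[x∧y]≈[y∧z]∧x L x y z) (∧-comm x y)

  [y∧z]∧x≤y∧x : (y ∧ z) ∧ x ≤ y ∧ x
  [y∧z]∧x≤y∧x = ∧-monotonic (x∧y≤x y z) ≤-refl
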